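{- For all $m\ge 6$, \[ \gamma^{\mathrm{SID}}(K_m\times P_n)=\begin{cases}3m,& n=5,\\ 3m+6,& n=6.\end{cases} \]
   Context: For a vertex $v$, $N[v]$ is its closed neighborhood. A nonempty set $S\subseteq V(G)$ is a self-identifying code of $G$ if for every vertex $v\in V(G)$: (1) $N[v]\cap S\neq\emptyset$, and (2) $\bigcap_{c\in N[v]\cap S}N[c]=\{v\}$; $\gamma^{\mathrm{SID}}(G)$ is the minimum size of such a code. With $V(K_m)=\{v_0,\dots,v_{m-1}\}$ and $V(P_n)=\{0,\dots,n-1\}$ (consecutively numbered path), the direct product $K_m\times P_n$ has vertices $(v_i,j)$, with $(v_i,j)$ adjacent to $(v_{i'},j')$ iff $i\neq i'$ and $|j-j'|=1$. -}

module Defs where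

open import Data.Nat using (ℕ; suc; _+_; _≤_)
open import Data.Fin using (Fin; toℕ)
open import Data.Bool using (Bool; true; false)
open import Data.List using (List; map; concatMap; allFin)
open import Data.Nat.ListAction using (sum)
open import Data.Product using (_×_; _,_; ∃-syntax)
open import Data.Sum using (_⊎_)
open import Relation.Binary.PropositionalEquality using (_≡_; _≢_)

module SID {V : Set} (Adj : V → V → Set) where

  _∈N[_] : V → V → Set
  w ∈N[ v ] = (w ≡ v) ⊎ Adj v w

  -- S is a self-identifying code:
  --  (1) N[v] ∩ S ≠ ∅  for every v
  --  (2) ⋂_{c ∈ N[v] ∩ S} N[c] = {v}  for every v
  --      (v always lies in this intersection; so the condition is that
  --       every w in the intersection equals v)
  -- Nonemptiness of S follows from (1) as the graphs considered are nonempty.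
  IsSID : (V → Bool) → Set
  IsSID S = (v : V) →
      (∃[ c ] (c ∈N[ v ] × S c ≡ true))
    × ((w : V) → ((c : V) → c ∈N[ v ] → S c ≡ true → w ∈N[ c ]) → w ≡ v)

KP-V : ℕ → ℕ → Set
KP-V m n = Fin m × Fin n

KP-Adj : (m n : ℕ) → KP-V m n → KP-V m n → Set
KP-Adj m n (i , j) (i' , j') =
  (i ≢ i') × ((toℕ j' ≡ suc (toℕ j)) ⊎ (toℕ j ≡ suc (toℕ j')))

KP-vertices : (m n : ℕ) → List (KP-V m n)
KP-vertices m n = concatMap (λ i → map (λ j → (i , j)) (allFin n)) (allFin m)

b2n : Bool → ℕ
b2n true = 1
b2n false = 0

size : (m n : ℕ) → (KP-V m n → Bool) → ℕ
size m n S = sum (map (λ v → b2n (S v)) (KP-vertices m n))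

IsSIDCode : (m n : ℕ) → (KP-V m n → Bool) → Set
IsSIDCode m n = SID.IsSID (KP-Adj m n)

γSID≡ : (m n k : ℕ) → Set
γSID≡ m n k =
  (∃[ S ] (IsSIDCode m n S × size m n S ≡ k))
  × ((S : KP-V m n → Bool) → IsSIDCode m n S → k ≤ size m n S)

-- The end layers of an SID code of K_m × P_n lie entirely in the code (a missing
-- (x , 0) could not be told apart from (x , 2)), and the layer next to an end layer
-- holds at least three code vertices (an end vertex (i , 0) has to be separated from
-- every (a , 1) with a ≠ i). A non-code vertex (x , j) forces, in every other
-- column, a code vertex in a layer adjacent to j. For n = 5 this puts m code
-- vertices into layers 1–3: if some column misses all three, every other column
-- contains layer 2. For n = 6 layers 1–4 carry m + 6: either layers 2 and 3 together
-- meet every column (and layers 1 and 4 add three each); or some column misses both,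
-- and layer 2 or 3 is full outside it while the other one is nonempty; or each of
-- layers 2, 3 has two non-code vertices, which forces every column to meet layers
-- {1, 3} and {2, 4}, so that 2m ≥ m + 6. With T = {v₀, v₁, v₂} the layer patterns
-- (V, T, ∅, V∖T, V) and (V, T, V, ∅, T, V) attain the bounds.

module Submission where

open import Defs
open import Data.Nat using (ℕ; zero; suc; _≤_; _<_; _*_; _+_; z≤n; s≤s)
open import Data.Nat.Properties hiding (_≟_)
open import Data.Nat.Tactic.RingSolver using (solve-∀)
open import Data.Product using (_×_; _,_; proj₁; proj₂; ∃)
open import Data.Sum using (_⊎_; inj₁; inj₂)
import Data.Sum as Sum
open import Data.Fin using (Fin; zero; suc; toℕ; fromℕ<; punchIn; _≟_)
open import Data.Fin.Patterns
open import Data.Fin.Properties using (toℕ-injective; toℕ<n; punchInᵢ≢i; any?)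
open import Data.Bool using (Bool; true; false; not)
import Data.Bool as Bool
open import Data.Bool.Properties using (¬-not; not-¬)
open import Data.List using (List; _++_; map; concatMap; tabulate; allFin)
open import Data.List.Properties using (map-++; map-∘)
import Data.Nat.ListAction as List
open import Data.Nat.ListAction.Properties using (sum-++)
open import Algebra.Properties.CommutativeMonoid.Sum +-0-commutativeMonoid
  using (sum-syntax; ∑-distrib-+; ∑-comm; sum-cong-≗; sum-replicate-zero)
open import Function using (_∘_; id)
open import Relation.Binary.PropositionalEquality
open import Relation.Nullary using (¬_; yes; no)
open import Relation.Nullary.Decidable using (_×-dec_; ¬?)
open import Relation.Unary using (Decidable)
open import Data.Empty using (⊥-elim)

-- Paths and layers

infix 4 _~_

_~_ : ℕ → ℕ → Set
j ~ k = (k ≡ suc j) ⊎ (j ≡ suc k)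

~-sym : ∀ {j k} → j ~ k → k ~ j
~-sym = Sum.swap

~-irrefl : ∀ {j} → ¬ (j ~ j)
~-irrefl (inj₁ e) = 1+n≢n (sym e)
~-irrefl (inj₂ e) = 1+n≢n (sym e)

~-triangle-free : ∀ {j k l} → j ~ k → k ~ l → ¬ (j ~ l)
~-triangle-free (inj₁ refl) (inj₁ refl) (inj₁ ())
~-triangle-free (inj₁ refl) (inj₁ refl) (inj₂ ())
~-triangle-free (inj₁ refl) (inj₂ refl) j~l = ~-irrefl j~l
~-triangle-free (inj₂ refl) (inj₁ refl) j~l = ~-irrefl j~l
~-triangle-free (inj₂ refl) (inj₂ refl) (inj₁ ())
~-triangle-free (inj₂ refl) (inj₂ refl) (inj₂ ())

~-common-neighbour : ∀ {j k₁ k₂ l} → j ~ k₁ → j ~ k₂ → k₁ ≢ k₂ → k₁ ~ l → k₂ ~ l → l ≡ j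
~-common-neighbour (inj₁ refl) (inj₁ refl) k₁≢k₂ _ _ = ⊥-elim (k₁≢k₂ refl)
~-common-neighbour (inj₂ refl) (inj₂ refl) k₁≢k₂ _ _ = ⊥-elim (k₁≢k₂ refl)
~-common-neighbour (inj₁ refl) (inj₂ refl) _ (inj₁ refl) (inj₁ ())
~-common-neighbour (inj₁ refl) (inj₂ refl) _ (inj₁ refl) (inj₂ ())
~-common-neighbour (inj₁ refl) (inj₂ refl) _ (inj₂ refl) _ = refl
~-common-neighbour (inj₂ refl) (inj₁ refl) _ (inj₁ refl) _ = refl
~-common-neighbour (inj₂ refl) (inj₁ refl) _ (inj₂ refl) (inj₁ ())
~-common-neighbour (inj₂ refl) (inj₁ refl) _ (inj₂ refl) (inj₂ ())

EndLayer : ∀ {n} → Fin n → Fin n → Set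
EndLayer j k = ∀ l → toℕ j ~ toℕ l → l ≡ k

Neighbours : ∀ {n} → Fin n → Fin n → Fin n → Set
Neighbours j k₁ k₂ = ∀ l → toℕ j ~ toℕ l → l ≡ k₁ ⊎ l ≡ k₂

endLayer-first : ∀ {n} → EndLayer {suc (suc n)} 0F 1F
endLayer-first l (inj₁ e) = toℕ-injective e

endLayer-last : ∀ {n} {j k : Fin n} → suc (toℕ k) ≡ toℕ j → suc (toℕ j) ≡ n → EndLayer j k
endLayer-last k+1≡j j+1≡n l (inj₁ e) = ⊥-elim (<-irrefl (trans e j+1≡n) (toℕ<n l))
endLayer-last k+1≡j j+1≡n l (inj₂ e) = toℕ-injective (suc-injective (trans (sym e) (sym k+1≡j)))

neighbours-interior : ∀ {n} {j k₁ k₂ : Fin n} → suc (toℕ k₁) ≡ toℕ j → suc (toℕ j) ≡ toℕ k₂ →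
                      Neighbours j k₁ k₂
neighbours-interior k₁+1≡j j+1≡k₂ l (inj₁ e) = inj₂ (toℕ-injective (trans e j+1≡k₂))
neighbours-interior k₁+1≡j j+1≡k₂ l (inj₂ e) = inj₁ (toℕ-injective (suc-injective (trans (sym e) (sym k₁+1≡j))))

neighbours-swap : ∀ {n} {j k₁ k₂ : Fin n} → Neighbours j k₁ k₂ → Neighbours j k₂ k₁
neighbours-swap nbrs l j~l = Sum.swap (nbrs l j~l)

-- Finite sums and counting

∑-mono-≤ : ∀ {m} {f g : Fin m → ℕ} → (∀ i → f i ≤ g i) → ∑[ i < m ] f i ≤ ∑[ i < m ] g i
∑-mono-≤ {zero} f≤g = z≤n
∑-mono-≤ {suc m} f≤g = +-mono-≤ (f≤g zero) (∑-mono-≤ (f≤g ∘ suc))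

∑-const : ∀ m c → ∑[ i < m ] c ≡ m * c
∑-const zero c = refl
∑-const (suc m) c = cong (c +_) (∑-const m c)

m≤∑ : ∀ {m} {f : Fin m → ℕ} → (∀ i → 1 ≤ f i) → m ≤ ∑[ i < m ] f i
m≤∑ {m} 1≤f = begin
  m                ≡⟨ *-identityʳ m ⟨
  m * 1            ≡⟨ ∑-const m 1 ⟨
  ∑[ i < m ] 1     ≤⟨ ∑-mono-≤ 1≤f ⟩
  ∑[ i < m ] _     ∎
  where open ≤-Reasoning

δ : ∀ {m} → Fin m → Fin m → ℕ
δ zero    zero    = 1
δ zero    (suc _) = 0
δ (suc _) zero    = 0
δ (suc b) (suc i) = δ b i

δ-diag : ∀ {m} (b : Fin m) → δ b b ≡ 1
δ-diag zero    = refl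
δ-diag (suc b) = δ-diag b

δ-off : ∀ {m} {b i : Fin m} → i ≢ b → δ b i ≡ 0
δ-off {b = zero}  {zero}  i≢b = ⊥-elim (i≢b refl)
δ-off {b = zero}  {suc i} i≢b = refl
δ-off {b = suc b} {zero}  i≢b = refl
δ-off {b = suc b} {suc i} i≢b = δ-off (i≢b ∘ cong suc)

∑δ≡1 : ∀ {m} (b : Fin m) → ∑[ i < m ] δ b i ≡ 1
∑δ≡1 {suc m} zero    = cong suc (sum-replicate-zero m)
∑δ≡1 {suc m} (suc b) = ∑δ≡1 b

δ-≤ : ∀ {m} {f : Fin m → Bool} {b} → f b ≡ true → ∀ i → δ b i ≤ b2n (f i)
δ-≤ {b = b} fb i with i ≟ b
... | yes refl = ≤-reflexive (trans (δ-diag i) (cong b2n (sym fb)))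
... | no i≢b  = ≤-trans (≤-reflexive (δ-off i≢b)) z≤n

δ-insert : ∀ {m} {f : Fin m → Bool} {g : Fin m → ℕ} {b} → f b ≡ true → g b ≡ 0 →
           (∀ i → g i ≤ b2n (f i)) → ∀ i → δ b i + g i ≤ b2n (f i)
δ-insert {b = b} fb gb g≤f i with i ≟ b
... | yes refl = ≤-reflexive (trans (cong₂ _+_ (δ-diag i) gb) (cong b2n (sym fb)))
... | no i≢b  = subst (_≤ _) (cong (_+ _) (sym (δ-off i≢b))) (g≤f i)

count : ∀ {m} → (Fin m → Bool) → ℕ
count {m} f = ∑[ i < m ] b2n (f i)

count-full : ∀ {m} {f : Fin m → Bool} → (∀ i → f i ≡ true) → m ≤ count f
count-full full = m≤∑ λ i → ≤-reflexive (cong b2n (sym (full i)))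

count-cover : ∀ {m} {f g : Fin m → Bool} → (∀ i → ¬ (f i ≡ false × g i ≡ false)) →
              m ≤ count f + count g
count-cover {m} {f} {g} cover =
  ≤-trans (m≤∑ (one≤ ∘ cover)) (≤-reflexive (∑-distrib-+ (b2n ∘ f) (b2n ∘ g)))
  where
  one≤ : ∀ {a b} → ¬ (a ≡ false × b ≡ false) → 1 ≤ b2n a + b2n b
  one≤ {true}           _  = s≤s z≤n
  one≤ {false} {true}   _  = s≤s z≤n
  one≤ {false} {false} ¬ff = ⊥-elim (¬ff (refl , refl))

count-cover₃ : ∀ {m} {f g h : Fin m → Bool} → (∀ i → ¬ (f i ≡ false × g i ≡ false × h i ≡ false)) →
               m ≤ count f + (count g + count h)
count-cover₃ {m} {f} {g} {h} cover =
  ≤-trans (m≤∑ (one≤ ∘ cover))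
          (≤-reflexive (trans (∑-distrib-+ (b2n ∘ f) (λ i → b2n (g i) + b2n (h i)))
                              (cong (count f +_) (∑-distrib-+ (b2n ∘ g) (b2n ∘ h)))))
  where
  one≤ : ∀ {a b c} → ¬ (a ≡ false × b ≡ false × c ≡ false) → 1 ≤ b2n a + (b2n b + b2n c)
  one≤ {true}                   _   = s≤s z≤n
  one≤ {false} {true}           _   = s≤s z≤n
  one≤ {false} {false} {true}   _   = s≤s z≤n
  one≤ {false} {false} {false} ¬fff = ⊥-elim (¬fff (refl , refl , refl))

count-pos : ∀ {m} {f : Fin m → Bool} → ¬ (∀ i → f i ≡ false) → 1 ≤ count f
count-pos {zero}  some = ⊥-elim (some λ ())
count-pos {suc m} {f} some with f zero in f₀
... | true  = s≤s z≤n
... | false = count-pos λ rest → some λ { zero → f₀ ; (suc i) → rest i }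

count-allBut : ∀ {m} {f : Fin m → Bool} x → (∀ i → ¬ (i ≢ x × f i ≡ false)) → m ≤ count f + 1
count-allBut {m} {f} x allBut = begin
  m                                  ≤⟨ m≤∑ one≤ ⟩
  ∑[ i < m ] (b2n (f i) + δ x i)     ≡⟨ ∑-distrib-+ (b2n ∘ f) (δ x) ⟩
  count f + ∑[ i < m ] δ x i         ≡⟨ cong (count f +_) (∑δ≡1 x) ⟩
  count f + 1                        ∎
  where
  open ≤-Reasoning
  one≤ : ∀ i → 1 ≤ b2n (f i) + δ x i
  one≤ i with i ≟ x
  ... | yes refl = ≤-trans (≤-reflexive (sym (δ-diag i))) (m≤n+m _ _)
  ... | no i≢x   = ≤-trans (≤-reflexive (cong b2n (sym (¬-not λ fi → allBut i (i≢x , fi)))))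
                           (m≤m+n _ _)

ThreeOrMore : ∀ {m} → (Fin m → Bool) → Set
ThreeOrMore {m} f = ∀ x y → ∃ λ a → (a ≢ x × a ≢ y) × f a ≡ true

threeOrMore⇒3≤count : ∀ {m} {f : Fin m → Bool} → 0 < m → ThreeOrMore f → 3 ≤ count f
threeOrMore⇒3≤count {m} {f} 0<m three
  with three (fromℕ< 0<m) (fromℕ< 0<m)
... | b₁ , _ , f₁ with three b₁ b₁
... | b₂ , (b₂≢b₁ , _) , f₂ with three b₁ b₂
... | b₃ , (b₃≢b₁ , b₃≢b₂) , f₃ = begin
  3                                                  ≡⟨ cong₂ _+_ (∑δ≡1 b₁) (cong₂ _+_ (∑δ≡1 b₂) (∑δ≡1 b₃)) ⟨
  ∑[ i < _ ] δ b₁ i + (∑[ i < _ ] δ b₂ i + ∑[ i < _ ] δ b₃ i)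
      ≡⟨ trans (∑-distrib-+ (δ b₁) (λ i → δ b₂ i + δ b₃ i))
               (cong (∑[ i < _ ] δ b₁ i +_) (∑-distrib-+ (δ b₂) (δ b₃))) ⟨
  ∑[ i < _ ] (δ b₁ i + (δ b₂ i + δ b₃ i))             ≤⟨ ∑-mono-≤ pointwise ⟩
  count f                                            ∎
  where
  open ≤-Reasoning
  pointwise : ∀ i → δ b₁ i + (δ b₂ i + δ b₃ i) ≤ b2n (f i)
  pointwise = δ-insert f₁ (cong₂ _+_ (δ-off (b₂≢b₁ ∘ sym)) (δ-off (b₃≢b₁ ∘ sym)))
                (δ-insert f₂ (δ-off (b₃≢b₂ ∘ sym)) (δ-≤ f₃))

distinct⇒threeOrMore : ∀ {m} {f : Fin m → Bool} {a b c} → a ≢ b → a ≢ c → b ≢ c →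
                   f a ≡ true → f b ≡ true → f c ≡ true → ThreeOrMore f
distinct⇒threeOrMore {a = a} {b} a≢b a≢c b≢c fa fb fc x y with a ≟ x | a ≟ y | b ≟ x | b ≟ y
... | no a≢x   | no a≢y   | _        | _        = a , (a≢x , a≢y) , fa
... | _        | _        | no b≢x   | no b≢y   = b , (b≢x , b≢y) , fb
... | yes refl | _        | _        | yes refl = _ , (a≢c ∘ sym , b≢c ∘ sym) , fc
... | _        | yes refl | yes refl | _        = _ , (b≢c ∘ sym , a≢c ∘ sym) , fc
... | yes refl | _        | yes refl | _        = ⊥-elim (a≢b refl)
... | _        | yes refl | _        | yes refl = ⊥-elim (a≢b refl)

find-true : ∀ {m} {P : Fin m → Set} → Decidable P → (f : Fin m → Bool) →
            ¬ (∀ a → P a → f a ≡ false) → ∃ λ a → P a × f a ≡ true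
find-true P? f none with any? (λ a → P? a ×-dec (f a Bool.≟ true))
... | yes found   = found
... | no notFound = ⊥-elim (none λ a pa → ¬-not λ fa → notFound (a , pa , fa))

another : ∀ {m} → 2 ≤ m → (x : Fin m) → ∃ λ y → y ≢ x
another (s≤s (s≤s _)) x = punchIn x zero , punchInᵢ≢i x zero

sum-map-tabulate : ∀ {A : Set} {m} (h : A → ℕ) (f : Fin m → A) →
                   List.sum (map h (tabulate f)) ≡ ∑[ i < m ] h (f i)
sum-map-tabulate {m = zero}  h f = refl
sum-map-tabulate {m = suc m} h f = cong (h (f zero) +_) (sum-map-tabulate h (f ∘ suc))

sum-map-concatMap-tabulate : ∀ {A B : Set} {m} (h : B → ℕ) (g : A → List B) (f : Fin m → A) →
                             List.sum (map h (concatMap g (tabulate f))) ≡ ∑[ i < m ] List.sum (map h (g (f i)))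
sum-map-concatMap-tabulate {m = zero}  h g f = refl
sum-map-concatMap-tabulate {m = suc m} h g f = begin
  List.sum (map h (g (f zero) ++ concatMap g (tabulate (f ∘ suc))))
    ≡⟨ cong List.sum (map-++ h (g (f zero)) _) ⟩
  List.sum (map h (g (f zero)) ++ map h (concatMap g (tabulate (f ∘ suc))))
    ≡⟨ sum-++ (map h (g (f zero))) _ ⟩
  List.sum (map h (g (f zero))) + List.sum (map h (concatMap g (tabulate (f ∘ suc))))
    ≡⟨ cong (List.sum (map h (g (f zero))) +_) (sum-map-concatMap-tabulate h g (f ∘ suc)) ⟩
  List.sum (map h (g (f zero))) + ∑[ i < m ] List.sum (map h (g (f (suc i))))
    ∎
  where open ≡-Reasoning

layer : ∀ {m n} → (KP-V m n → Bool) → Fin n → Fin m → Bool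
layer S j i = S (i , j)

size-by-columns : ∀ {m n} (S : KP-V m n → Bool) → size m n S ≡ ∑[ i < m ] ∑[ j < n ] b2n (S (i , j))
size-by-columns {m} {n} S =
  trans (sum-map-concatMap-tabulate (b2n ∘ S) (λ i → map (i ,_) (allFin n)) id)
        (sum-cong-≗ column-sum)
  where
  column-sum : ∀ i → List.sum (map (b2n ∘ S) (map (i ,_) (allFin n))) ≡ ∑[ j < n ] b2n (S (i , j))
  column-sum i = trans (cong List.sum (sym (map-∘ (allFin n)))) (sum-map-tabulate (b2n ∘ S ∘ (i ,_)) id)

size-by-layers : ∀ {m n} (S : KP-V m n → Bool) → size m n S ≡ ∑[ j < n ] count (layer S j)
size-by-layers S = trans (size-by-columns S) (∑-comm (λ i j → b2n (S (i , j))))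

-- Lower bounds

module SIDCodeProperties {m n : ℕ} {S : KP-V m n → Bool} (sid : IsSIDCode m n S) where
  open SID (KP-Adj m n)

  separates : ∀ {v w} → w ≢ v → ¬ (∀ c → c ∈N[ v ] → S c ≡ true → w ∈N[ c ])
  separates w≢v agrees = w≢v (proj₂ (sid _) _ agrees)

  nonCode-separates : ∀ {v w} → S v ≡ false → w ≢ v →
                      ¬ (∀ c → KP-Adj m n v c → S c ≡ true → w ∈N[ c ])
  nonCode-separates Sv w≢v agrees = separates w≢v λ
    { _ (inj₁ refl) Sc → ⊥-elim (not-¬ Sc Sv)
    ; c (inj₂ v~c)  Sc → agrees c v~c Sc }

  endLayer⊆code : ∀ {j j' j₂} → EndLayer j j' → toℕ j' ~ toℕ j₂ → j₂ ≢ j → ∀ x → S (x , j) ≡ true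
  endLayer⊆code {j₂ = j₂} end j'~j₂ j₂≢j x = ¬-not λ Sv → nonCode-separates Sv (j₂≢j ∘ cong proj₂) λ
    { (a , k) (x≢a , j~k) _ → inj₂ (x≢a ∘ sym , subst (λ k → toℕ k ~ toℕ j₂) (sym (end k j~k)) j'~j₂) }

  nextToEnd-avoidsPair : ∀ {j j'} → EndLayer j j' → toℕ j ~ toℕ j' →
                         ∀ i a → i ≢ a → ∃ λ b → (b ≢ i × b ≢ a) × S (b , j') ≡ true
  nextToEnd-avoidsPair {j} {j'} end j~j' i a i≢a =
    find-true (λ b → ¬? (b ≟ i) ×-dec ¬? (b ≟ a)) (layer S j') λ outside →
      separates {v = (i , j)} {w = (a , j')} (i≢a ∘ sym ∘ cong proj₁) (agrees outside)
    where
    agrees : (∀ b → b ≢ i × b ≢ a → S (b , j') ≡ false) →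
             ∀ c → c ∈N[ (i , j) ] → S c ≡ true → (a , j') ∈N[ c ]
    agrees _ _ (inj₁ refl) _ = inj₂ (i≢a , j~j')
    agrees outside (b , k) (inj₂ (i≢b , j~k)) Sc with end k j~k | b ≟ a
    ... | refl | yes refl = inj₁ refl
    ... | refl | no b≢a   = ⊥-elim (not-¬ Sc (outside b (i≢b ∘ sym , b≢a)))

  nextToEnd-threeOrMore : ∀ {j j'} → 2 ≤ m → EndLayer j j' → toℕ j ~ toℕ j' → ThreeOrMore (layer S j')
  nextToEnd-threeOrMore 2≤m end j~j' x y with x ≟ y
  ... | no x≢y   = nextToEnd-avoidsPair end j~j' x y x≢y
  ... | yes refl with another 2≤m x
  ... | z , z≢x with nextToEnd-avoidsPair end j~j' x z (z≢x ∘ sym)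
  ... | a , (a≢x , _) , Sa = a , (a≢x , a≢x) , Sa

  nextToEnd-3≤count : ∀ {j j'} → 2 ≤ m → EndLayer j j' → toℕ j ~ toℕ j' → 3 ≤ count (layer S j')
  nextToEnd-3≤count 2≤m end j~j' =
    threeOrMore⇒3≤count (≤-trans (s≤s z≤n) 2≤m) (nextToEnd-threeOrMore 2≤m end j~j')

  nonCode-meets : ∀ {x y j k₁ k₂} → S (x , j) ≡ false → y ≢ x → Neighbours j k₁ k₂ →
                  ¬ (S (y , k₁) ≡ false × S (y , k₂) ≡ false)
  nonCode-meets {x} {y} {j} Sv y≢x nbrs (f₁ , f₂) = nonCode-separates Sv (y≢x ∘ cong proj₁) agrees
    where
    agrees : ∀ c → KP-Adj m n (x , j) c → S c ≡ true → (y , j) ∈N[ c ]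
    agrees (a , k) (_ , j~k) Sc with a ≟ y
    ... | no a≢y = inj₂ (a≢y , ~-sym j~k)
    ... | yes refl with nbrs k j~k
    ...   | inj₁ refl = ⊥-elim (not-¬ Sc f₁)
    ...   | inj₂ refl = ⊥-elim (not-¬ Sc f₂)

  nonCode-pair-cover : ∀ {x y j k₁ k₂} → S (x , j) ≡ false → S (y , j) ≡ false → x ≢ y →
                       Neighbours j k₁ k₂ → ∀ i → ¬ (S (i , k₁) ≡ false × S (i , k₂) ≡ false)
  nonCode-pair-cover {x} Sx Sy x≢y nbrs i with i ≟ x
  ... | yes refl = nonCode-meets Sy x≢y nbrs
  ... | no i≢x   = nonCode-meets Sx i≢x nbrs

  nonCode-farLayer : ∀ {x j k₁ k₂ j₀} → S (x , j) ≡ false → Neighbours j k₁ k₂ →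
                     toℕ k₁ ~ toℕ j₀ → j₀ ≢ j → ¬ (∀ a → S (a , k₂) ≡ false)
  nonCode-farLayer {x} {j} {j₀ = j₀} Sv nbrs k₁~j₀ j₀≢j noCode =
    nonCode-separates Sv (j₀≢j ∘ cong proj₂) agrees
    where
    agrees : ∀ c → KP-Adj m n (x , j) c → S c ≡ true → (x , j₀) ∈N[ c ]
    agrees (a , k) (x≢a , j~k) Sc with nbrs k j~k
    ... | inj₁ refl = inj₂ (x≢a ∘ sym , k₁~j₀)
    ... | inj₂ refl = ⊥-elim (not-¬ Sc (noCode a))

layerSum₅≥3m : ∀ {m} (c : Fin 5 → ℕ) → m ≤ c 0F → m ≤ c 1F + (c 2F + c 3F) → m ≤ c 4F →
               3 * m ≤ ∑[ j < 5 ] c j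
layerSum₅≥3m {m} c h₀ h₁₂₃ h₄ = begin
  3 * m                                        ≡⟨ regroupˡ m ⟩
  m + (m + m)                                  ≤⟨ +-mono-≤ h₀ (+-mono-≤ h₁₂₃ h₄) ⟩
  c 0F + ((c 1F + (c 2F + c 3F)) + c 4F)       ≡⟨ regroupʳ (c 0F) (c 1F) (c 2F) (c 3F) (c 4F) ⟩
  ∑[ j < 5 ] c j                               ∎
  where
  open ≤-Reasoning
  regroupˡ : ∀ m → 3 * m ≡ m + (m + m)
  regroupˡ = solve-∀
  regroupʳ : ∀ a b c d e → a + ((b + (c + d)) + e) ≡ a + (b + (c + (d + (e + 0))))
  regroupʳ = solve-∀

layerSum₆≥3m+6 : ∀ {m} (c : Fin 6 → ℕ) → m ≤ c 0F → m + 6 ≤ c 1F + (c 2F + (c 3F + c 4F)) → m ≤ c 5F →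
                 3 * m + 6 ≤ ∑[ j < 6 ] c j
layerSum₆≥3m+6 {m} c h₀ h₁₂₃₄ h₅ = begin
  3 * m + 6                                    ≡⟨ regroupˡ m ⟩
  m + ((m + 6) + m)                            ≤⟨ +-mono-≤ h₀ (+-mono-≤ h₁₂₃₄ h₅) ⟩
  c 0F + ((c 1F + (c 2F + (c 3F + c 4F))) + c 5F) ≡⟨ regroupʳ (c 0F) (c 1F) (c 2F) (c 3F) (c 4F) (c 5F) ⟩
  ∑[ j < 6 ] c j                               ∎
  where
  open ≤-Reasoning
  regroupˡ : ∀ m → 3 * m + 6 ≡ m + ((m + 6) + m)
  regroupˡ = solve-∀
  regroupʳ : ∀ a b c d e f → a + ((b + (c + (d + e))) + f) ≡ a + (b + (c + (d + (e + (f + 0)))))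
  regroupʳ = solve-∀

middleLayers₅ : ∀ {m} {S : KP-V m 5 → Bool} → 2 ≤ m → IsSIDCode m 5 S →
                m ≤ count (layer S 1F) + (count (layer S 2F) + count (layer S 3F))
middleLayers₅ {m} {S} 2≤m sid
  with any? (λ x → (S (x , 1F) Bool.≟ false) ×-dec (S (x , 2F) Bool.≟ false) ×-dec (S (x , 3F) Bool.≟ false))
... | no noEmptyColumn = count-cover₃ (λ i empty → noEmptyColumn (i , empty))
... | yes (x , f₁ , _ , f₃) = begin
  m                     ≤⟨ count-allBut x layer₂-outside-x ⟩
  c 2F + 1              ≤⟨ +-monoʳ-≤ (c 2F) (≤-trans (s≤s z≤n) 3≤c₁) ⟩
  c 2F + c 1F           ≡⟨ +-comm (c 2F) (c 1F) ⟩
  c 1F + c 2F           ≤⟨ +-monoʳ-≤ (c 1F) (m≤m+n (c 2F) (c 3F)) ⟩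
  c 1F + (c 2F + c 3F)  ∎
  where
  open ≤-Reasoning
  open SIDCodeProperties sid
  c : Fin 5 → ℕ
  c j = count (layer S j)
  3≤c₁ : 3 ≤ c 1F
  3≤c₁ = nextToEnd-3≤count 2≤m endLayer-first (inj₁ refl)
  layer₂-outside-x : ∀ i → ¬ (i ≢ x × S (i , 2F) ≡ false)
  layer₂-outside-x i (i≢x , Si) = nonCode-meets Si (i≢x ∘ sym) (neighbours-interior refl refl) (f₁ , f₃)

lowerBound₅ : ∀ {m} {S : KP-V m 5 → Bool} → 2 ≤ m → IsSIDCode m 5 S → 3 * m ≤ size m 5 S
lowerBound₅ {m} {S} 2≤m sid = begin
  3 * m                         ≤⟨ layerSum₅≥3m c (count-full firstLayer) (middleLayers₅ 2≤m sid)
                                                  (count-full lastLayer) ⟩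
  ∑[ j < 5 ] count (layer S j)  ≡⟨ size-by-layers S ⟨
  size m 5 S                    ∎
  where
  open ≤-Reasoning
  open SIDCodeProperties sid
  c : Fin 5 → ℕ
  c j = count (layer S j)
  firstLayer : ∀ x → S (x , 0F) ≡ true
  firstLayer = endLayer⊆code endLayer-first (inj₁ refl) (λ ())
  lastLayer : ∀ x → S (x , 4F) ≡ true
  lastLayer = endLayer⊆code (endLayer-last refl refl) (inj₂ refl) (λ ())

middleLayers₆ : ∀ {m} {S : KP-V m 6 → Bool} → IsSIDCode m 6 S →
                m ≤ count (layer S 2F) + count (layer S 3F)
                ⊎ (m ≤ count (layer S 1F) + count (layer S 3F) × m ≤ count (layer S 2F) + count (layer S 4F))
middleLayers₆ {m} {S} sid = cases
  where
  open ≤-Reasoning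
  open SIDCodeProperties sid
  c : Fin 6 → ℕ
  c j = count (layer S j)
  nbrs₂ : Neighbours 2F 1F 3F
  nbrs₂ = neighbours-interior refl refl
  nbrs₃ : Neighbours 3F 2F 4F
  nbrs₃ = neighbours-interior refl refl
  nbrs₃′ : Neighbours 3F 4F 2F
  nbrs₃′ = neighbours-swap nbrs₃

  cases : m ≤ c 2F + c 3F ⊎ (m ≤ c 1F + c 3F × m ≤ c 2F + c 4F)
  cases with any? (λ x → (S (x , 2F) Bool.≟ false) ×-dec (S (x , 3F) Bool.≟ false))
  ... | no noHole = inj₁ (count-cover λ i hole → noHole (i , hole))
  ... | yes (x , f₂ , f₃) with any? (λ y → ¬? (y ≟ x) ×-dec (S (y , 2F) Bool.≟ false))
  ...   | no only₂ = inj₁ (begin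
          m            ≤⟨ count-allBut x (λ y hole → only₂ (y , hole)) ⟩
          c 2F + 1     ≤⟨ +-monoʳ-≤ (c 2F) (count-pos (nonCode-farLayer f₂ nbrs₂ (inj₂ refl) (λ ()))) ⟩
          c 2F + c 3F  ∎)
  ...   | yes (y , y≢x , g₂) with any? (λ y → ¬? (y ≟ x) ×-dec (S (y , 3F) Bool.≟ false))
  ...     | no only₃ = inj₁ (begin
            m            ≤⟨ count-allBut x (λ y hole → only₃ (y , hole)) ⟩
            c 3F + 1     ≡⟨ +-comm (c 3F) 1 ⟩
            1 + c 3F     ≤⟨ +-monoˡ-≤ (c 3F) (count-pos (nonCode-farLayer f₃ nbrs₃′ (inj₁ refl) (λ ()))) ⟩
            c 2F + c 3F  ∎)
  ...     | yes (y' , y'≢x , g₃) =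
            inj₂ (count-cover (nonCode-pair-cover f₂ g₂ (y≢x ∘ sym) nbrs₂) ,
                  count-cover (nonCode-pair-cover f₃ g₃ (y'≢x ∘ sym) nbrs₃))

lowerBound₆ : ∀ {m} {S : KP-V m 6 → Bool} → 6 ≤ m → IsSIDCode m 6 S → 3 * m + 6 ≤ size m 6 S
lowerBound₆ {m} {S} 6≤m sid = begin
  3 * m + 6                     ≤⟨ layerSum₆≥3m+6 c (count-full firstLayer) middle (count-full lastLayer) ⟩
  ∑[ j < 6 ] count (layer S j)  ≡⟨ size-by-layers S ⟨
  size m 6 S                    ∎
  where
  open ≤-Reasoning
  open SIDCodeProperties sid
  c : Fin 6 → ℕ
  c j = count (layer S j)

  firstLayer : ∀ x → S (x , 0F) ≡ true
  firstLayer = endLayer⊆code endLayer-first (inj₁ refl) (λ ())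
  lastLayer : ∀ x → S (x , 5F) ≡ true
  lastLayer = endLayer⊆code (endLayer-last refl refl) (inj₂ refl) (λ ())

  2≤m : 2 ≤ m
  2≤m = ≤-trans (s≤s (s≤s z≤n)) 6≤m
  3≤c₁ : 3 ≤ c 1F
  3≤c₁ = nextToEnd-3≤count 2≤m endLayer-first (inj₁ refl)
  3≤c₄ : 3 ≤ c 4F
  3≤c₄ = nextToEnd-3≤count 2≤m (endLayer-last refl refl) (inj₂ refl)

  middle : m + 6 ≤ c 1F + (c 2F + (c 3F + c 4F))
  middle with middleLayers₆ sid
  ... | inj₁ h₂₃ = begin
    m + (3 + 3)                      ≤⟨ +-mono-≤ h₂₃ (+-mono-≤ 3≤c₁ 3≤c₄) ⟩
    (c 2F + c 3F) + (c 1F + c 4F)    ≡⟨ regroup (c 1F) (c 2F) (c 3F) (c 4F) ⟩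
    c 1F + (c 2F + (c 3F + c 4F))    ∎
    where
    regroup : ∀ a b c d → (b + c) + (a + d) ≡ a + (b + (c + d))
    regroup = solve-∀
  ... | inj₂ (h₁₃ , h₂₄) = begin
    m + 6                            ≤⟨ +-monoʳ-≤ m 6≤m ⟩
    m + m                            ≤⟨ +-mono-≤ h₁₃ h₂₄ ⟩
    (c 1F + c 3F) + (c 2F + c 4F)    ≡⟨ regroup (c 1F) (c 2F) (c 3F) (c 4F) ⟩
    c 1F + (c 2F + (c 3F + c 4F))    ∎
    where
    regroup : ∀ a b c d → (a + c) + (b + d) ≡ a + (b + (c + d))
    regroup = solve-∀

-- Codes attaining the bounds

module SIDCriteria {m n : ℕ} (S : KP-V m n → Bool) where
  open SID (KP-Adj m n)

  Dominated : KP-V m n → Set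
  Dominated v = ∃ λ c → c ∈N[ v ] × S c ≡ true

  Identified : KP-V m n → Set
  Identified v = ∀ w → (∀ c → c ∈N[ v ] → S c ≡ true → w ∈N[ c ]) → w ≡ v

  codeVertex-SID : ∀ {x j k} → S (x , j) ≡ true → toℕ j ~ toℕ k → ThreeOrMore (layer S k) →
                   Dominated (x , j) × Identified (x , j)
  codeVertex-SID {x} {j} {k} Sv j~k three = ((x , j) , inj₁ refl , Sv) , identified
    where
    identified : Identified (x , j)
    identified (y , l) agrees with agrees (x , j) (inj₁ refl) Sv
    ... | inj₁ w≡v = w≡v
    ... | inj₂ (x≢y , j~l) with three x y
    ...   | a , (a≢x , a≢y) , Sa with agrees (a , k) (inj₂ (a≢x ∘ sym , j~k)) Sa
    ...     | inj₁ w≡c       = ⊥-elim (a≢y (sym (cong proj₁ w≡c)))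
    ...     | inj₂ (_ , k~l) = ⊥-elim (~-triangle-free j~k k~l j~l)

  separatedPair-SID : ∀ {x j c₁ c₂} → KP-Adj m n (x , j) c₁ → S c₁ ≡ true →
                      KP-Adj m n (x , j) c₂ → S c₂ ≡ true →
                      (∀ w → w ∈N[ c₁ ] → w ∈N[ c₂ ] → proj₂ w ≡ j) →
                      (∀ z → z ≢ x → ∃ λ k → toℕ j ~ toℕ k × S (z , k) ≡ true) →
                      Dominated (x , j) × Identified (x , j)
  separatedPair-SID {x} {j} adj₁ S₁ adj₂ S₂ commonInLayer cover = (_ , inj₂ adj₁ , S₁) , identified
    where
    identified : Identified (x , j)
    identified (y , l) agrees with commonInLayer (y , l) (agrees _ (inj₂ adj₁) S₁) (agrees _ (inj₂ adj₂) S₂)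
    ... | refl with y ≟ x
    ...   | yes refl = refl
    ...   | no y≢x with cover y y≢x
    ...     | k , j~k , Sk with agrees (y , k) (inj₂ (y≢x ∘ sym , j~k)) Sk
    ...       | inj₁ e         = ⊥-elim (~-irrefl (subst (λ k → toℕ j ~ toℕ k) (sym (cong proj₂ e)) j~k))
    ...       | inj₂ (y≢y , _) = ⊥-elim (y≢y refl)

  commonNbrs-sandwich : ∀ {j a k₁ b k₂} → toℕ j ~ toℕ k₁ → toℕ j ~ toℕ k₂ → toℕ k₁ ≢ toℕ k₂ →
                        ∀ w → w ∈N[ (a , k₁) ] → w ∈N[ (b , k₂) ] → proj₂ w ≡ j
  commonNbrs-sandwich j~k₁ j~k₂ k₁≢k₂ _ (inj₁ refl) (inj₁ e) = ⊥-elim (k₁≢k₂ (cong (toℕ ∘ proj₂) e))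
  commonNbrs-sandwich j~k₁ j~k₂ k₁≢k₂ _ (inj₁ refl) (inj₂ (_ , k₂~k₁)) =
    ⊥-elim (~-triangle-free j~k₂ k₂~k₁ j~k₁)
  commonNbrs-sandwich j~k₁ j~k₂ k₁≢k₂ _ (inj₂ (_ , k₁~k₂)) (inj₁ refl) =
    ⊥-elim (~-triangle-free j~k₁ k₁~k₂ j~k₂)
  commonNbrs-sandwich j~k₁ j~k₂ k₁≢k₂ _ (inj₂ (_ , k₁~l)) (inj₂ (_ , k₂~l)) =
    toℕ-injective (~-common-neighbour j~k₁ j~k₂ k₁≢k₂ k₁~l k₂~l)

  commonNbrs-endLayer : ∀ {j a b k} → a ≢ b → EndLayer k j →
                        ∀ w → w ∈N[ (a , k) ] → w ∈N[ (b , k) ] → proj₂ w ≡ j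
  commonNbrs-endLayer a≢b end _ (inj₁ refl)        (inj₁ e)          = ⊥-elim (a≢b (cong proj₁ e))
  commonNbrs-endLayer a≢b end _ (inj₁ refl)        (inj₂ (_ , k~k)) = ⊥-elim (~-irrefl k~k)
  commonNbrs-endLayer a≢b end _ (inj₂ (_ , k~k))  (inj₁ refl)       = ⊥-elim (~-irrefl k~k)
  commonNbrs-endLayer a≢b end (_ , l) (inj₂ (_ , k~l)) (inj₂ _)      = end l k~l

  sandwich-SID : ∀ {x j a k₁ b k₂} → toℕ j ~ toℕ k₁ → toℕ j ~ toℕ k₂ → toℕ k₁ ≢ toℕ k₂ →
                 a ≢ x → S (a , k₁) ≡ true → b ≢ x → S (b , k₂) ≡ true →
                 (∀ z → z ≢ x → ∃ λ k → toℕ j ~ toℕ k × S (z , k) ≡ true) →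
                 Dominated (x , j) × Identified (x , j)
  sandwich-SID j~k₁ j~k₂ k₁≢k₂ a≢x Sa b≢x Sb =
    separatedPair-SID (a≢x ∘ sym , j~k₁) Sa (b≢x ∘ sym , j~k₂) Sb (commonNbrs-sandwich j~k₁ j~k₂ k₁≢k₂)

  besideFullEnd-SID : ∀ {x j k} → EndLayer k j → toℕ j ~ toℕ k → (∀ z → S (z , k) ≡ true) →
                      ThreeOrMore {m} (λ _ → true) → Dominated (x , j) × Identified (x , j)
  besideFullEnd-SID {x} {j} {k} end j~k full three with three x x
  ... | a , (a≢x , _) , _ with three x a
  ... | b , (b≢x , b≢a) , _ =
    separatedPair-SID (a≢x ∘ sym , j~k) (full a) (b≢x ∘ sym , j~k) (full b)
      (commonNbrs-endLayer (b≢a ∘ sym) end) (λ z _ → k , j~k , full z)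

small : ∀ {m} → Fin m → Bool
small 0F = true
small 1F = true
small 2F = true
small _  = false

threeOrMore-small : ∀ {k} → ThreeOrMore (small {3 + k})
threeOrMore-small = distinct⇒threeOrMore {a = 0F} {1F} {2F} (λ ()) (λ ()) (λ ()) refl refl refl

threeOrMore-large : ∀ {k} → ThreeOrMore (not ∘ small {6 + k})
threeOrMore-large = distinct⇒threeOrMore {a = 3F} {4F} {5F} (λ ()) (λ ()) (λ ()) refl refl refl

threeOrMore-all : ∀ {k} → ThreeOrMore (λ (_ : Fin (3 + k)) → true)
threeOrMore-all = distinct⇒threeOrMore {a = 0F} {1F} {2F} (λ ()) (λ ()) (λ ()) refl refl refl

count-small : ∀ k → count (small {3 + k}) ≡ 3
count-small k = cong (3 +_) (sum-replicate-zero k)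

code₅ : ∀ {m} → KP-V m 5 → Bool
code₅ (i , 0F) = true
code₅ (i , 1F) = small i
code₅ (i , 2F) = false
code₅ (i , 3F) = not (small i)
code₅ (i , 4F) = true

code₅-SID : ∀ k → IsSIDCode (6 + k) 5 code₅
code₅-SID k = sid
  where
  open SIDCriteria (code₅ {6 + k})
  sid : IsSIDCode (6 + k) 5 code₅
  sid (x , 0F) = codeVertex-SID refl (inj₁ refl) threeOrMore-small
  sid (x , 1F) with small x in e
  ... | true  = codeVertex-SID e (inj₂ refl) threeOrMore-all
  ... | false = besideFullEnd-SID endLayer-first (inj₂ refl) (λ _ → refl) threeOrMore-all
  sid (x , 2F) with threeOrMore-small x x | threeOrMore-large x x
  ... | a , (a≢x , _) , Sa | b , (b≢x , _) , Sb =
    sandwich-SID (inj₂ refl) (inj₁ refl) (λ ()) a≢x Sa b≢x Sb cover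
    where
    cover : ∀ z → z ≢ x → ∃ λ k → 2 ~ toℕ k × code₅ (z , k) ≡ true
    cover z _ with small z in e
    ... | true  = 1F , inj₂ refl , e
    ... | false = 3F , inj₁ refl , cong not e
  sid (x , 3F) with small x in e
  ... | false = codeVertex-SID (cong not e) (inj₁ refl) threeOrMore-all
  ... | true  = besideFullEnd-SID (endLayer-last refl refl) (inj₁ refl) (λ _ → refl) threeOrMore-all
  sid (x , 4F) = codeVertex-SID refl (inj₂ refl) threeOrMore-large

size-code₅ : ∀ k → size (6 + k) 5 code₅ ≡ 3 * (6 + k)
size-code₅ k = begin
  size (6 + k) 5 code₅                               ≡⟨ size-by-columns (code₅ {6 + k}) ⟩
  ∑[ i < 6 + k ] ∑[ j < 5 ] b2n (code₅ (i , j))      ≡⟨ sum-cong-≗ {6 + k} (column≡3 ∘ small) ⟩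
  ∑[ i < 6 + k ] 3                                   ≡⟨ ∑-const (6 + k) 3 ⟩
  (6 + k) * 3                                        ≡⟨ *-comm (6 + k) 3 ⟩
  3 * (6 + k)                                        ∎
  where
  open ≡-Reasoning
  -- The left-hand side is the normal form of ∑[ j < 5 ] b2n (code₅ (i , j)) with s = small i.
  column≡3 : ∀ s → 1 + (b2n s + (0 + (b2n (not s) + (1 + 0)))) ≡ 3
  column≡3 true  = refl
  column≡3 false = refl

code₆ : ∀ {m} → KP-V m 6 → Bool
code₆ (i , 0F) = true
code₆ (i , 1F) = small i
code₆ (i , 2F) = true
code₆ (i , 3F) = false
code₆ (i , 4F) = small i
code₆ (i , 5F) = true

code₆-SID : ∀ k → IsSIDCode (6 + k) 6 code₆
code₆-SID k = sid
  where
  open SIDCriteria (code₆ {6 + k})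
  sid : IsSIDCode (6 + k) 6 code₆
  sid (x , 0F) = codeVertex-SID refl (inj₁ refl) threeOrMore-small
  sid (x , 1F) with small x in e
  ... | true  = codeVertex-SID e (inj₂ refl) threeOrMore-all
  ... | false = besideFullEnd-SID endLayer-first (inj₂ refl) (λ _ → refl) threeOrMore-all
  sid (x , 2F) = codeVertex-SID refl (inj₂ refl) threeOrMore-small
  sid (x , 3F) with threeOrMore-all x x | threeOrMore-small x x
  ... | a , (a≢x , _) , _ | b , (b≢x , _) , Sb =
    sandwich-SID (inj₂ refl) (inj₁ refl) (λ ()) a≢x refl b≢x Sb (λ z _ → 2F , inj₂ refl , refl)
  sid (x , 4F) with small x in e
  ... | true  = codeVertex-SID e (inj₁ refl) threeOrMore-all
  ... | false = besideFullEnd-SID (endLayer-last refl refl) (inj₁ refl) (λ _ → refl) threeOrMore-all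
  sid (x , 5F) = codeVertex-SID refl (inj₂ refl) threeOrMore-small

size-code₆ : ∀ k → size (6 + k) 6 code₆ ≡ 3 * (6 + k) + 6
size-code₆ k = begin
  size (6 + k) 6 code₆
    ≡⟨ size-by-columns (code₆ {6 + k}) ⟩
  ∑[ i < 6 + k ] ∑[ j < 6 ] b2n (code₆ (i , j))
    ≡⟨ sum-cong-≗ {6 + k} (column≡ ∘ small) ⟩
  ∑[ i < 6 + k ] (3 + (b2n (small i) + b2n (small i)))
    ≡⟨ ∑-distrib-+ {6 + k} (λ _ → 3) (λ i → b2n (small i) + b2n (small i)) ⟩
  ∑[ i < 6 + k ] 3 + ∑[ i < 6 + k ] (b2n (small i) + b2n (small i))
    ≡⟨ cong₂ _+_ (∑-const (6 + k) 3) (∑-distrib-+ (b2n ∘ small {6 + k}) (b2n ∘ small)) ⟩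
  (6 + k) * 3 + (count (small {6 + k}) + count (small {6 + k}))
    ≡⟨ cong₂ _+_ (*-comm (6 + k) 3) (cong₂ _+_ (count-small (3 + k)) (count-small (3 + k))) ⟩
  3 * (6 + k) + 6
    ∎
  where
  open ≡-Reasoning
  column≡ : ∀ s → 1 + (b2n s + (1 + (0 + (b2n s + (1 + 0))))) ≡ 3 + (b2n s + b2n s)
  column≡ true  = refl
  column≡ false = refl

theoremA4 : (m : ℕ) → 6 ≤ m →
    γSID≡ m 5 (3 * m) × γSID≡ m 6 (3 * m + 6)
theoremA4 m 6≤m with m≤n⇒∃[o]m+o≡n 6≤m
... | k , refl =
  ((code₅ , code₅-SID k , size-code₅ k) , λ _ sid → lowerBound₅ (s≤s (s≤s z≤n)) sid) ,
  ((code₆ , code₆-SID k , size-code₆ k) , λ _ sid → lowerBound₆ 6≤m sid)
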